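{- For all $n,t\in\mathbb{N}$, the graph $\Theta_t$ on $\mathcal{M}_{2n-1}$ is isomorphic to the graph $\Gamma_t$ on $\mathcal{M}_{2n}$.
   Context: $\mathcal{M}_{2n}$ is the set of perfect matchings of $K_{2n}$ and $\Gamma_t$ is the graph on $\mathcal{M}_{2n}$ in which $m,m'$ are adjacent iff $|m\cap m'|<t$. $\mathcal{M}_{2n-1}$ is the set of near-perfect matchings of $K_{2n-1}$ (matchings with $n-1$ edges, missing exactly one vertex). For $m,m'\in\mathcal{M}_{2n-1}$ the multigraph union $m\cup m'$ consists of disjoint even cycles (a common edge being a 2-cycle) and exactly one path with an even number of edges (possibly a single vertex, when $m$ and $m'$ miss the same vertex); listing the numbers of vertices of these components in non-increasing order gives a partition $d'(m,m')\vdash 2n-1$ with exactly one odd part. $\Theta_t$ is the graph on $\mathcal{M}_{2n-1}$ in which $m,m'$ are adjacent iff $d'(m,m')$ has fewer than $t$ parts of size at most $2$. -}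

module Defs where

open import Data.Nat using (ℕ; zero; suc; _+_; _*_; _∸_; _<_; _≤_)
open import Data.Bool using (Bool; true; false; if_then_else_; _∨_)
open import Data.Fin using (Fin; toℕ) renaming (zero to fzero; suc to fsuc)
open import Data.Fin.Subset using (Subset; ⁅_⁆; _∈_; ∣_∣) renaming (_∪_ to _∪ₛ_)
open import Data.Fin.Subset.Properties using (_∈?_)
open import Data.Fin.Properties using (all?)
open import Data.Vec using (Vec; lookup; tabulate)
open import Data.Product using (Σ; _×_; _,_)
open import Relation.Binary.PropositionalEquality using (_≡_; _≢_)
open import Relation.Nullary using (Dec; yes; no; ¬_)
open import Relation.Nullary.Decidable using (⌊_⌋; _×-dec_)
open import Relation.Unary using (Decidable)
open import Function.Bundles using (_⤖_; _⇔_; Bijection)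
import Data.Fin.Properties as FinP
import Data.Nat.Properties as NatP

-- A (near-)perfect matching m of K_N on vertex set Fin N is encoded by the
-- map  f : Fin N → Fin N  (stored as a vector) sending a covered vertex i to
-- its partner (the edge of m at i is {i , f i}) and an uncovered vertex to
-- itself.  The edge set of m is { {i , f i} | f i ≢ i }.

Involution : ∀ {N} → Vec (Fin N) N → Set
Involution f = ∀ i → lookup f (lookup f i) ≡ i

IsPerfectMatching : ∀ {N} → Vec (Fin N) N → Set
IsPerfectMatching f = Involution f × (∀ i → lookup f i ≢ i)

IsNearPerfectMatching : ∀ {N} → Vec (Fin N) N → Set
IsNearPerfectMatching {N} f =
  Involution f × Σ (Fin N) (λ v → lookup f v ≡ v × (∀ w → lookup f w ≡ w → w ≡ v))

record PerfectMatching (N : ℕ) : Set where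
  constructor pm
  field
    vec    : Vec (Fin N) N
    .valid : IsPerfectMatching vec

record NearPerfectMatching (N : ℕ) : Set where
  constructor npm
  field
    vec    : Vec (Fin N) N
    .valid : IsNearPerfectMatching vec

count : ∀ {N} {P : Fin N → Set} → Decidable P → ℕ
count {zero}  P? = 0
count {suc N} P? = (if ⌊ P? fzero ⌋ then 1 else 0) + count (λ i → P? (fsuc i))

-- |m ∩ m'| : number of common edges {i , f i} (counted once via i < f i)

commonEdges : ∀ {N} → Vec (Fin N) N → Vec (Fin N) N → ℕ
commonEdges f g =
  count (λ i → (toℕ i NatP.<? toℕ (lookup f i)) ×-dec (lookup f i FinP.≟ lookup g i))

step : ∀ {N} → Vec (Fin N) N → Vec (Fin N) N → Subset N → Subset N
step f g S = S ∪ₛ tabulate (λ j → ⌊ lookup f j ∈? S ⌋ ∨ ⌊ lookup g j ∈? S ⌋)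

iterateN : ∀ {A : Set} → ℕ → (A → A) → A → A
iterateN zero    h x = x
iterateN (suc k) h x = h (iterateN k h x)

-- vertex set of the component of v in m ∪ m' (N closure steps suffice)
component : ∀ {N} → Vec (Fin N) N → Vec (Fin N) N → Fin N → Subset N
component {N} f g v = iterateN N (step f g) ⁅ v ⁆

IsLeastInComponent : ∀ {N} → Vec (Fin N) N → Vec (Fin N) N → Fin N → Set
IsLeastInComponent f g v = ∀ w → w ∈ component f g v → toℕ v ≤ toℕ w

isLeast? : ∀ {N} (f g : Vec (Fin N) N) → Decidable (IsLeastInComponent f g)
isLeast? f g v = all? (λ w → dec w)
  where
  dec : ∀ w → Dec (w ∈ component f g v → toℕ v ≤ toℕ w)
  dec w with w ∈? component f g v | toℕ v NatP.≤? toℕ w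
  ... | _     | yes p = yes (λ _ → p)
  ... | no ¬q | no _  = yes (λ q → Data.Empty.⊥-elim (¬q q))
    where import Data.Empty
  ... | yes q | no ¬p = no (λ h → ¬p (h q))

-- number of parts of size at most 2 of d'(m,m') = number of components of
-- m ∪ m' with at most 2 vertices (each counted via its least vertex)
smallParts : ∀ {N} → Vec (Fin N) N → Vec (Fin N) N → ℕ
smallParts f g =
  count (λ v → isLeast? f g v ×-dec (∣ component f g v ∣ NatP.≤? 2))

record Graph : Set₁ where
  field
    V   : Set
    Adj : V → V → Set

Γ : ℕ → ℕ → Graph
Γ n t = record
  { V   = PerfectMatching (2 * n)
  ; Adj = λ m m' → commonEdges (PerfectMatching.vec m) (PerfectMatching.vec m') < t }

Θ : ℕ → ℕ → Graph
Θ n t = record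
  { V   = NearPerfectMatching (2 * n ∸ 1)
  ; Adj = λ m m' → smallParts (NearPerfectMatching.vec m) (NearPerfectMatching.vec m') < t }

record _≅_ (G H : Graph) : Set where
  field
    bij       : Graph.V G ⤖ Graph.V H
    adjacency : ∀ x y → Graph.Adj G x y ⇔ Graph.Adj H (Bijection.to bij x) (Bijection.to bij y)

-- Join a new vertex 0 to the uncovered vertex: this turns a near-perfect matching m of
-- K_{2n-1} into a perfect matching m̂ of K_{2n}, and deleting vertex 0 undoes it.  A
-- component of m ∪ m' with at most two vertices is either a common edge or the common
-- uncovered vertex (a component through an uncovered vertex of only one of m, m' is a
-- path with at least three vertices).  The common edges of m̂ and m̂' are exactly the
-- common edges of m and m' together with the edge at 0 when m and m' miss the same
-- vertex, so d'(m,m') has as many parts of size at most 2 as |m̂ ∩ m̂'|.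
module Submission where

open import Defs
open import Data.Bool using (Bool; true; false; _∨_; if_then_else_)
open import Data.Empty using (⊥-elim)
open import Data.Fin using (Fin; toℕ) renaming (zero to fzero; suc to fsuc)
open import Data.Fin.Properties using (_≟_; any?; all?; 0≢1+n; suc-injective; toℕ-injective; toℕ<n)
open import Data.Fin.Subset using (Subset; ⁅_⁆; _∈_; _∉_; _⊆_; _∪_; ∣_∣)
open import Data.Fin.Subset.Properties
  using (_∈?_; x∈p∪q⁺; x∈p∪q⁻; x∈⁅x⁆; x∈⁅y⁆⇒x≡y; ∣⁅x⁆∣≡1; ∣p∣≤∣x∷p∣; p⊆p∪q; p⊆q⇒∣p∣≤∣q∣; p⊂q⇒∣p∣<∣q∣)
open import Data.Nat using (ℕ; zero; suc; _+_; _*_; _∸_; _<_; _≤_; z≤n; s≤s)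
import Data.Nat.Properties as ℕ
open import Data.Product using (∃; _×_; _,_; proj₁; proj₂)
open import Data.Sum using (_⊎_; inj₁; inj₂)
import Data.Sum as Sum
open import Data.Vec using (Vec; []; _∷_; lookup; tabulate)
open import Data.Vec.Properties using (lookup∘tabulate; tabulate∘lookup; tabulate-cong; lookup⇒[]=; []=⇒lookup)
open import Function using (_∘_)
open import Function.Bundles using (_⇔_; mk⇔; mk↔ₛ′; Equivalence)
open import Function.Properties.Equivalence using () renaming (trans to ⇔-trans)
open import Function.Properties.Inverse using (↔⇒⤖)
open import Relation.Binary.PropositionalEquality
open import Relation.Nullary using (Dec; yes; no; ¬_)
open import Relation.Nullary.Decidable
  using (⌊_⌋; _×-dec_; _⊎-dec_; _→-dec_; ¬?; recompute; isYes≗does; does-⇔)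
open import Relation.Unary using (Decidable)

infixl 9 _!_
_!_ : ∀ {A : Set} {n} → Vec A n → Fin n → A
_!_ = lookup

lookup-ext : ∀ {A : Set} {n} {u v : Vec A n} → (∀ i → u ! i ≡ v ! i) → u ≡ v
lookup-ext {u = u} {v} u≗v =
  trans (sym (tabulate∘lookup u)) (trans (tabulate-cong u≗v) (tabulate∘lookup v))

⌊⌋-⇔ : ∀ {A B : Set} → A ⇔ B → (a? : Dec A) (b? : Dec B) → ⌊ a? ⌋ ≡ ⌊ b? ⌋
⌊⌋-⇔ A⇔B a? b? = trans (isYes≗does a?) (trans (does-⇔ A⇔B a? b?) (sym (isYes≗does b?)))

⌊⌋∨⌊⌋≡true⇔ : ∀ {A B : Set} (a? : Dec A) (b? : Dec B) → (⌊ a? ⌋ ∨ ⌊ b? ⌋ ≡ true) ⇔ (A ⊎ B)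
⌊⌋∨⌊⌋≡true⇔ (yes a) _       = mk⇔ (λ _ → inj₁ a) (λ _ → refl)
⌊⌋∨⌊⌋≡true⇔ (no _)  (yes b) = mk⇔ (λ _ → inj₂ b) (λ _ → refl)
⌊⌋∨⌊⌋≡true⇔ (no ¬a) (no ¬b) = mk⇔ (λ ()) (⊥-elim ∘ Sum.[ ¬a , ¬b ])

∈-tabulate⇔ : ∀ {n} {h : Fin n → Bool} {x} → x ∈ tabulate h ⇔ h x ≡ true
∈-tabulate⇔ {h = h} {x} =
  mk⇔ (λ x∈ → trans (sym (lookup∘tabulate h x)) ([]=⇒lookup x∈))
      (λ hx≡true → lookup⇒[]= x (tabulate h) (trans (lookup∘tabulate h x) hx≡true))

count-cong : ∀ {n} {P Q : Fin n → Set} (P? : Decidable P) (Q? : Decidable Q) →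
             (∀ i → P i ⇔ Q i) → count P? ≡ count Q?
count-cong {zero}  _  _  _   = refl
count-cong {suc n} P? Q? P⇔Q =
  cong₂ _+_ (cong (λ b → if b then 1 else 0) (⌊⌋-⇔ (P⇔Q fzero) (P? fzero) (Q? fzero)))
            (count-cong (P? ∘ fsuc) (Q? ∘ fsuc) (P⇔Q ∘ fsuc))

count-⊎ : ∀ {n} {P Q : Fin n → Set} (P? : Decidable P) (Q? : Decidable Q) →
          (∀ i → P i → ¬ Q i) → count (λ i → P? i ⊎-dec Q? i) ≡ count P? + count Q?
count-⊎ {zero}  _  _  _ = refl
count-⊎ {suc n} P? Q? disjoint
  with P? fzero | Q? fzero | count-⊎ (P? ∘ fsuc) (Q? ∘ fsuc) (disjoint ∘ fsuc)
... | yes p | yes q | _  = ⊥-elim (disjoint fzero p q)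
... | yes _ | no _  | ih = cong suc ih
... | no _  | yes _ | ih = trans (cong suc ih) (sym (ℕ.+-suc _ _))
... | no _  | no _  | ih = ih

count-empty : ∀ {n} {P : Fin n → Set} (P? : Decidable P) → (∀ i → ¬ P i) → count P? ≡ 0
count-empty {zero}  _  _  = refl
count-empty {suc n} P? ¬P with P? fzero
... | yes p = ⊥-elim (¬P fzero p)
... | no _  = count-empty (P? ∘ fsuc) (¬P ∘ fsuc)

count-singleton : ∀ {n} {P : Fin n → Set} (P? : Decidable P) {c} →
                  P c → (∀ i → P i → i ≡ c) → count P? ≡ 1
count-singleton {suc n} P? {fzero} Pc unique with P? fzero
... | yes _ = cong suc (count-empty (P? ∘ fsuc) (λ i Pi → 0≢1+n (sym (unique (fsuc i) Pi))))
... | no ¬P0 = ⊥-elim (¬P0 Pc)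
count-singleton {suc n} P? {fsuc c} Pc unique with P? fzero
... | yes P0 = ⊥-elim (0≢1+n (unique fzero P0))
... | no _   = count-singleton (P? ∘ fsuc) Pc (λ i Pi → suc-injective (unique (fsuc i) Pi))

count-subsingleton : ∀ {n} {P : Fin n → Set} (P? : Decidable P) →
                     (∀ {i j} → P i → P j → i ≡ j) → count P? ≡ (if ⌊ any? P? ⌋ then 1 else 0)
count-subsingleton P? unique with any? P?
... | yes (c , Pc) = count-singleton P? Pc (λ i Pi → unique Pi Pc)
... | no ∄P        = count-empty P? (λ i Pi → ∄P (i , Pi))

∣p∪q∣≤∣p∣+∣q∣ : ∀ {n} (p q : Subset n) → ∣ p ∪ q ∣ ≤ ∣ p ∣ + ∣ q ∣
∣p∪q∣≤∣p∣+∣q∣ []          []          = z≤n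
∣p∪q∣≤∣p∣+∣q∣ (true ∷ p)  (b ∷ q)     =
  s≤s (ℕ.≤-trans (∣p∪q∣≤∣p∣+∣q∣ p q) (ℕ.+-monoʳ-≤ ∣ p ∣ (∣p∣≤∣x∷p∣ b q)))
∣p∪q∣≤∣p∣+∣q∣ (false ∷ p) (false ∷ q) = ∣p∪q∣≤∣p∣+∣q∣ p q
∣p∪q∣≤∣p∣+∣q∣ (false ∷ p) (true ∷ q)  =
  ℕ.≤-trans (s≤s (∣p∪q∣≤∣p∣+∣q∣ p q)) (ℕ.≤-reflexive (sym (ℕ.+-suc ∣ p ∣ ∣ q ∣)))

∣p∣<∣p∪⁅x⁆∣ : ∀ {n} {p : Subset n} {x} → x ∉ p → ∣ p ∣ < ∣ p ∪ ⁅ x ⁆ ∣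
∣p∣<∣p∪⁅x⁆∣ {x = x} x∉p = p⊂q⇒∣p∣<∣q∣ (p⊆p∪q ⁅ x ⁆ , x , x∈p∪q⁺ (inj₂ (x∈⁅x⁆ x)) , x∉p)

∪⁅⁆-⊆ : ∀ {n} {p q : Subset n} {x} → q ⊆ p → x ∈ p → q ∪ ⁅ x ⁆ ⊆ p
∪⁅⁆-⊆ {q = q} {x} q⊆p x∈p y∈ with x∈p∪q⁻ q ⁅ x ⁆ y∈
... | inj₁ y∈q = q⊆p y∈q
... | inj₂ y∈⁅x⁆ rewrite x∈⁅y⁆⇒x≡y x y∈⁅x⁆ = x∈p

∣p∣≤2 : ∀ {n} {p : Subset n} a b → (∀ x → x ∈ p → x ≡ a ⊎ x ≡ b) → ∣ p ∣ ≤ 2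
∣p∣≤2 {p = p} a b p⊆ab = begin
  ∣ p ∣                   ≤⟨ p⊆q⇒∣p∣≤∣q∣ (x∈p∪q⁺ ∘ Sum.map (singleton _) (singleton _) ∘ p⊆ab _) ⟩
  ∣ ⁅ a ⁆ ∪ ⁅ b ⁆ ∣        ≤⟨ ∣p∪q∣≤∣p∣+∣q∣ ⁅ a ⁆ ⁅ b ⁆ ⟩
  ∣ ⁅ a ⁆ ∣ + ∣ ⁅ b ⁆ ∣     ≡⟨ cong₂ _+_ (∣⁅x⁆∣≡1 a) (∣⁅x⁆∣≡1 b) ⟩
  2                       ∎
  where
  open ℕ.≤-Reasoning
  singleton : ∀ {x} y → x ≡ y → x ∈ ⁅ y ⁆
  singleton y refl = x∈⁅x⁆ y

3≤∣p∣ : ∀ {n} {p : Subset n} {a b c} →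
        a ∈ p → b ∈ p → c ∈ p → a ≢ b → a ≢ c → b ≢ c → 3 ≤ ∣ p ∣
3≤∣p∣ {p = p} {a} {b} {c} a∈p b∈p c∈p a≢b a≢c b≢c = begin
  3                            ≡⟨ cong (2 +_) (sym (∣⁅x⁆∣≡1 a)) ⟩
  2 + ∣ ⁅ a ⁆ ∣                 ≤⟨ s≤s (∣p∣<∣p∪⁅x⁆∣ b∉a) ⟩
  1 + ∣ ⁅ a ⁆ ∪ ⁅ b ⁆ ∣         ≤⟨ ∣p∣<∣p∪⁅x⁆∣ c∉ab ⟩
  ∣ (⁅ a ⁆ ∪ ⁅ b ⁆) ∪ ⁅ c ⁆ ∣   ≤⟨ p⊆q⇒∣p∣≤∣q∣ (∪⁅⁆-⊆ (∪⁅⁆-⊆ a⊆p b∈p) c∈p) ⟩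
  ∣ p ∣                        ∎
  where
  open ℕ.≤-Reasoning
  a⊆p : ⁅ a ⁆ ⊆ p
  a⊆p x∈a rewrite x∈⁅y⁆⇒x≡y a x∈a = a∈p
  b∉a : b ∉ ⁅ a ⁆
  b∉a b∈a = a≢b (sym (x∈⁅y⁆⇒x≡y a b∈a))
  c∉ab : c ∉ ⁅ a ⁆ ∪ ⁅ b ⁆
  c∉ab c∈ab with x∈p∪q⁻ ⁅ a ⁆ ⁅ b ⁆ c∈ab
  ... | inj₁ c∈a = a≢c (sym (x∈⁅y⁆⇒x≡y a c∈a))
  ... | inj₂ c∈b = b≢c (sym (x∈⁅y⁆⇒x≡y b c∈b))

involution? : ∀ {N} (f : Vec (Fin N) N) → Dec (Involution f)
involution? f = all? (λ i → f ! (f ! i) ≟ i)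

isPerfectMatching? : ∀ {N} (f : Vec (Fin N) N) → Dec (IsPerfectMatching f)
isPerfectMatching? f = involution? f ×-dec all? (λ i → ¬? (f ! i ≟ i))

isNearPerfectMatching? : ∀ {N} (f : Vec (Fin N) N) → Dec (IsNearPerfectMatching f)
isNearPerfectMatching? f =
  involution? f ×-dec any? (λ v → (f ! v ≟ v) ×-dec all? (λ w → (f ! w ≟ w) →-dec (w ≟ v)))

newPartner : ∀ {M} → Vec (Fin M) M → Fin (suc M)
newPartner f with any? (λ j → f ! j ≟ j)
... | yes (u , _) = fsuc u
... | no _        = fzero

newPartner-uncovered : ∀ {M} {f : Vec (Fin M) M} {u} → f ! u ≡ u → (∀ w → f ! w ≡ w → w ≡ u) →
                       newPartner f ≡ fsuc u
newPartner-uncovered {f = f} fu≡u unique with any? (λ j → f ! j ≟ j)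
... | yes (w , fw≡w) = cong fsuc (unique w fw≡w)
... | no ∄fixed      = ⊥-elim (∄fixed (_ , fu≡u))

liftPartner : ∀ {M} → Fin M → Fin M → Fin (suc M)
liftPartner j k with k ≟ j
... | yes _ = fzero
... | no _  = fsuc k

liftPartner-self : ∀ {M} (j : Fin M) → liftPartner j j ≡ fzero
liftPartner-self j with j ≟ j
... | yes _   = refl
... | no j≢j  = ⊥-elim (j≢j refl)

liftPartner-other : ∀ {M} {j k : Fin M} → k ≢ j → liftPartner j k ≡ fsuc k
liftPartner-other {j = j} {k} k≢j with k ≟ j
... | yes k≡j = ⊥-elim (k≢j k≡j)
... | no _    = refl

lowerPartner : ∀ {M} → Fin M → Fin (suc M) → Fin M
lowerPartner j fzero    = j
lowerPartner j (fsuc k) = k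

lowerPartner-liftPartner : ∀ {M} (j k : Fin M) → lowerPartner j (liftPartner j k) ≡ k
lowerPartner-liftPartner j k with k ≟ j
... | yes k≡j = sym k≡j
... | no _    = refl

liftPartner-lowerPartner : ∀ {M} (j : Fin M) K → K ≢ fsuc j → liftPartner j (lowerPartner j K) ≡ K
liftPartner-lowerPartner j fzero    _    = liftPartner-self j
liftPartner-lowerPartner j (fsuc k) K≢sj = liftPartner-other (K≢sj ∘ cong fsuc)

lowerPartner-fixed : ∀ {M} {j : Fin M} {K} → lowerPartner j K ≡ j → K ≢ fsuc j → K ≡ fzero
lowerPartner-fixed {K = fzero}  _    _    = refl
lowerPartner-fixed {K = fsuc k} refl K≢sj = ⊥-elim (K≢sj refl)

-- Vertex j of K_M becomes vertex fsuc j; the new vertex fzero is matched with the uncovered vertex.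
extend : ∀ {M} → Vec (Fin M) M → Vec (Fin (suc M)) (suc M)
extend f = newPartner f ∷ tabulate (λ j → liftPartner j (f ! j))

restrict : ∀ {M} → Vec (Fin (suc M)) (suc M) → Vec (Fin M) M
restrict G = tabulate (λ j → lowerPartner j (G ! fsuc j))

module _ {M} (f : Vec (Fin M) M) {j : Fin M} where

  extend-covered : f ! j ≢ j → extend f ! fsuc j ≡ fsuc (f ! j)
  extend-covered fj≢j = trans (lookup∘tabulate _ j) (liftPartner-other fj≢j)

  extend-uncovered : f ! j ≡ j → extend f ! fsuc j ≡ fzero
  extend-uncovered fj≡j =
    trans (lookup∘tabulate _ j) (trans (cong (liftPartner j) fj≡j) (liftPartner-self j))

  extend-fsuc⁻ : ∀ {k} → extend f ! fsuc j ≡ fsuc k → f ! j ≡ k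
  extend-fsuc⁻ F[sj]≡sk = begin
    f ! j                                   ≡⟨ lowerPartner-liftPartner j (f ! j) ⟨
    lowerPartner j (liftPartner j (f ! j))  ≡⟨ cong (lowerPartner j) (sym (lookup∘tabulate _ j)) ⟩
    lowerPartner j (extend f ! fsuc j)      ≡⟨ cong (lowerPartner j) F[sj]≡sk ⟩
    _                                       ∎
    where open ≡-Reasoning

restrict-lookup : ∀ {M} (G : Vec (Fin (suc M)) (suc M)) j → restrict G ! j ≡ lowerPartner j (G ! fsuc j)
restrict-lookup G j = lookup∘tabulate _ j

extend-isPerfectMatching : ∀ {M} {f : Vec (Fin M) M} →
                           IsNearPerfectMatching f → IsPerfectMatching (extend f)
extend-isPerfectMatching {f = f} (f-inv , u , fu≡u , unique) = F-inv , F-nofix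
  where
  F = extend f
  F0≡su : F ! fzero ≡ fsuc u
  F0≡su = newPartner-uncovered fu≡u unique
  F-inv : Involution F
  F-inv fzero = trans (cong (F !_) F0≡su) (extend-uncovered f fu≡u)
  F-inv (fsuc j) with f ! j ≟ j
  ... | yes fj≡j = trans (cong (F !_) (extend-uncovered f fj≡j))
                          (trans F0≡su (cong fsuc (sym (unique j fj≡j))))
  ... | no fj≢j  = begin
    F ! (F ! fsuc j)     ≡⟨ cong (F !_) (extend-covered f fj≢j) ⟩
    F ! fsuc (f ! j)     ≡⟨ extend-covered f (λ ffj≡fj → fj≢j (trans (sym ffj≡fj) (f-inv j))) ⟩
    fsuc (f ! (f ! j))   ≡⟨ cong fsuc (f-inv j) ⟩
    fsuc j               ∎
    where open ≡-Reasoning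
  F-nofix : ∀ i → F ! i ≢ i
  F-nofix fzero F0≡0 = 0≢1+n (trans (sym F0≡0) F0≡su)
  F-nofix (fsuc j) F[sj]≡sj with f ! j ≟ j
  ... | yes fj≡j = 0≢1+n (trans (sym (extend-uncovered f fj≡j)) F[sj]≡sj)
  ... | no fj≢j  = fj≢j (extend-fsuc⁻ f F[sj]≡sj)

module _ {M} (G : Vec (Fin (suc M)) (suc M)) (G-pm : IsPerfectMatching G) where
  private
    G-inv = proj₁ G-pm
    G-nofix = proj₂ G-pm

    restrict-at : ∀ {j K} → G ! fsuc j ≡ K → restrict G ! j ≡ lowerPartner j K
    restrict-at {j} G[sj]≡K = trans (restrict-lookup G j) (cong (lowerPartner j) G[sj]≡K)

  restrict-uncovered : ∀ {u} → G ! fzero ≡ fsuc u →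
                       restrict G ! u ≡ u × (∀ w → restrict G ! w ≡ w → w ≡ u)
  restrict-uncovered {u} G0≡su = gu≡u , unique
    where
    gu≡u : restrict G ! u ≡ u
    gu≡u = restrict-at (trans (cong (G !_) (sym G0≡su)) (G-inv fzero))
    unique : ∀ w → restrict G ! w ≡ w → w ≡ u
    unique w gw≡w = suc-injective (begin
      fsuc w                 ≡⟨ G-inv (fsuc w) ⟨
      G ! (G ! fsuc w)       ≡⟨ cong (G !_) G[sw]≡0 ⟩
      G ! fzero              ≡⟨ G0≡su ⟩
      fsuc u                 ∎)
      where
      open ≡-Reasoning
      G[sw]≡0 : G ! fsuc w ≡ fzero
      G[sw]≡0 = lowerPartner-fixed (trans (sym (restrict-lookup G w)) gw≡w) (G-nofix (fsuc w))

  restrict-isNearPerfectMatching : IsNearPerfectMatching (restrict G)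
  restrict-isNearPerfectMatching = g-inv , uncovered
    where
    g = restrict G
    g-inv : Involution g
    g-inv j with G ! fsuc j in G[sj]
    ... | fzero  = trans (cong (g !_) (restrict-at G[sj])) (restrict-at G[sj])
    ... | fsuc k = trans (cong (g !_) (restrict-at G[sj]))
                         (restrict-at (trans (cong (G !_) (sym G[sj])) (G-inv (fsuc j))))
    uncovered : ∃ λ u → g ! u ≡ u × (∀ w → g ! w ≡ w → w ≡ u)
    uncovered with G ! fzero in G0
    ... | fzero  = ⊥-elim (G-nofix fzero G0)
    ... | fsuc u = u , restrict-uncovered G0

  extend-restrict : extend (restrict G) ≡ G
  extend-restrict = lookup-ext pointwise
    where
    pointwise : ∀ i → extend (restrict G) ! i ≡ G ! i
    pointwise fzero with G ! fzero in G0
    ... | fzero  = ⊥-elim (G-nofix fzero G0)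
    ... | fsuc u = newPartner-uncovered (proj₁ (restrict-uncovered G0)) (proj₂ (restrict-uncovered G0))
    pointwise (fsuc j) = begin
      extend (restrict G) ! fsuc j                ≡⟨ lookup∘tabulate _ j ⟩
      liftPartner j (restrict G ! j)              ≡⟨ cong (liftPartner j) (restrict-lookup G j) ⟩
      liftPartner j (lowerPartner j (G ! fsuc j)) ≡⟨ liftPartner-lowerPartner j _ (G-nofix (fsuc j)) ⟩
      G ! fsuc j                                  ∎
      where open ≡-Reasoning

restrict-extend : ∀ {M} (f : Vec (Fin M) M) → restrict (extend f) ≡ f
restrict-extend f = lookup-ext λ j → begin
  restrict (extend f) ! j                 ≡⟨ restrict-lookup (extend f) j ⟩
  lowerPartner j (extend f ! fsuc j)      ≡⟨ cong (lowerPartner j) (lookup∘tabulate _ j) ⟩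
  lowerPartner j (liftPartner j (f ! j))  ≡⟨ lowerPartner-liftPartner j (f ! j) ⟩
  f ! j                                   ∎
  where open ≡-Reasoning

module Components {M} (f g : Vec (Fin M) M) where

  ∈-step⇔ : ∀ {S x} → x ∈ step f g S ⇔ (x ∈ S ⊎ (f ! x ∈ S ⊎ g ! x ∈ S))
  ∈-step⇔ {S} {x} = mk⇔ to from
    where
    neighbours = tabulate (λ j → ⌊ f ! j ∈? S ⌋ ∨ ⌊ g ! j ∈? S ⌋)
    x∈neighbours⇔ : x ∈ neighbours ⇔ (f ! x ∈ S ⊎ g ! x ∈ S)
    x∈neighbours⇔ = ⇔-trans ∈-tabulate⇔ (⌊⌋∨⌊⌋≡true⇔ (f ! x ∈? S) (g ! x ∈? S))
    to : x ∈ step f g S → x ∈ S ⊎ (f ! x ∈ S ⊎ g ! x ∈ S)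
    to x∈ = Sum.map₂ (Equivalence.to x∈neighbours⇔) (x∈p∪q⁻ S neighbours x∈)
    from : x ∈ S ⊎ (f ! x ∈ S ⊎ g ! x ∈ S) → x ∈ step f g S
    from = x∈p∪q⁺ ∘ Sum.map₂ (Equivalence.from x∈neighbours⇔)

  ball : Fin M → ℕ → Subset M
  ball v k = iterateN k (step f g) ⁅ v ⁆

  ball⊆component : ∀ {v x} k → x ∈ ball v k → k ≤ M → x ∈ component f g v
  ball⊆component {v} {x} k x∈ k≤M = subst (λ m → x ∈ ball v m) (ℕ.m∸n+n≡m k≤M) (widen (M ∸ k))
    where
    widen : ∀ j → x ∈ ball v (j + k)
    widen zero    = x∈
    widen (suc j) = Equivalence.from ∈-step⇔ (inj₁ (widen j))

  module Involutive (f-inv : Involution f) (g-inv : Involution g) where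

    f∈ball : ∀ v k {x} → x ∈ ball v k → f ! x ∈ ball v (suc k)
    f∈ball v k {x} x∈ = Equivalence.from ∈-step⇔ (inj₂ (inj₁ (subst (_∈ _) (sym (f-inv x)) x∈)))

    g∈ball : ∀ v k {x} → x ∈ ball v k → g ! x ∈ ball v (suc k)
    g∈ball v k {x} x∈ = Equivalence.from ∈-step⇔ (inj₂ (inj₂ (subst (_∈ _) (sym (g-inv x)) x∈)))

    component-closed : ∀ (P : Fin M → Set) {v} → P v →
                       (∀ {x} → P x → P (f ! x)) → (∀ {x} → P x → P (g ! x)) →
                       ∀ x → x ∈ component f g v → P x
    component-closed P {v} Pv Pf Pg x = inBall M
      where
      inBall : ∀ k {x} → x ∈ ball v k → P x
      inBall zero    x∈ rewrite x∈⁅y⁆⇒x≡y v x∈ = Pv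
      inBall (suc k) {x} x∈ with Equivalence.to ∈-step⇔ x∈
      ... | inj₁ x∈′         = inBall k x∈′
      ... | inj₂ (inj₁ fx∈) = subst P (f-inv x) (Pf (inBall k fx∈))
      ... | inj₂ (inj₂ gx∈) = subst P (g-inv x) (Pg (inBall k gx∈))

-- The decision procedures are chosen so that commonEdges f g and smallParts f g are by definition
-- count (commonEdgeAt? f g) and count (smallPartRoot? f g).
CommonEdgeAt : ∀ {N} → Vec (Fin N) N → Vec (Fin N) N → Fin N → Set
CommonEdgeAt f g i = toℕ i < toℕ (f ! i) × f ! i ≡ g ! i

commonEdgeAt? : ∀ {N} (f g : Vec (Fin N) N) → Decidable (CommonEdgeAt f g)
commonEdgeAt? f g i = (toℕ i ℕ.<? toℕ (f ! i)) ×-dec (f ! i ≟ g ! i)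

CommonlyUncovered : ∀ {N} → Vec (Fin N) N → Vec (Fin N) N → Fin N → Set
CommonlyUncovered f g v = f ! v ≡ v × g ! v ≡ v

commonlyUncovered? : ∀ {N} (f g : Vec (Fin N) N) → Decidable (CommonlyUncovered f g)
commonlyUncovered? f g v = (f ! v ≟ v) ×-dec (g ! v ≟ v)

SmallPartRoot : ∀ {N} → Vec (Fin N) N → Vec (Fin N) N → Fin N → Set
SmallPartRoot f g v = IsLeastInComponent f g v × ∣ component f g v ∣ ≤ 2

smallPartRoot? : ∀ {N} (f g : Vec (Fin N) N) → Decidable (SmallPartRoot f g)
smallPartRoot? f g v = isLeast? f g v ×-dec (∣ component f g v ∣ ℕ.≤? 2)

distinct⇒2≤n : ∀ {n} {a b : Fin n} → a ≢ b → 2 ≤ n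
distinct⇒2≤n {suc zero}    {fzero} {fzero} a≢b = ⊥-elim (a≢b refl)
distinct⇒2≤n {suc (suc n)} _                   = s≤s (s≤s z≤n)

pair-closed : ∀ {M} (p : Vec (Fin M) M) → Involution p → ∀ {v w} → p ! v ≡ w →
              ∀ {x} → x ≡ v ⊎ x ≡ w → p ! x ≡ v ⊎ p ! x ≡ w
pair-closed p p-inv     pv≡w (inj₁ refl) = inj₂ pv≡w
pair-closed p p-inv {v} pv≡w (inj₂ refl) = inj₁ (trans (cong (p !_) (sym pv≡w)) (p-inv v))

uncovered-unique : ∀ {M} (p : Vec (Fin M) M) → IsNearPerfectMatching p →
                   ∀ {v w} → p ! v ≡ v → p ! w ≡ w → w ≡ v
uncovered-unique p (_ , _ , _ , unique) pv≡v pw≡w = trans (unique _ pw≡w) (sym (unique _ pv≡v))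

uncovered-path-distinct : ∀ {M} (p q : Vec (Fin M) M) {v} →
                          IsNearPerfectMatching p → p ! v ≡ v → q ! v ≢ v →
                          v ≢ p ! (q ! v) × q ! v ≢ p ! (q ! v)
uncovered-path-distinct p q {v} p-npm@(p-inv , _) pv≡v qv≢v = v≢pqv , qv≢pqv
  where
  v≢pqv : v ≢ p ! (q ! v)
  v≢pqv v≡pqv = qv≢v (begin
    q ! v                ≡⟨ p-inv (q ! v) ⟨
    p ! (p ! (q ! v))    ≡⟨ cong (p !_) v≡pqv ⟨
    p ! v                ≡⟨ pv≡v ⟩
    v                    ∎)
    where open ≡-Reasoning
  qv≢pqv : q ! v ≢ p ! (q ! v)
  qv≢pqv qv≡pqv = qv≢v (uncovered-unique p p-npm pv≡v (sym qv≡pqv))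

module SmallParts {M} (f g : Vec (Fin M) M)
                  (f-npm : IsNearPerfectMatching f) (g-npm : IsNearPerfectMatching g) where
  open Components f g
  open Involutive (proj₁ f-npm) (proj₁ g-npm)
  private
    self∈component : ∀ v → v ∈ component f g v
    self∈component v = ball⊆component 0 (x∈⁅x⁆ v) z≤n

    f∈component : ∀ v → f ! v ∈ component f g v
    f∈component v = ball⊆component 1 (f∈ball v 0 (x∈⁅x⁆ v)) (ℕ.≤-trans (s≤s z≤n) (toℕ<n v))

    g∈component : ∀ v → g ! v ∈ component f g v
    g∈component v = ball⊆component 1 (g∈ball v 0 (x∈⁅x⁆ v)) (ℕ.≤-trans (s≤s z≤n) (toℕ<n v))

    fg∈component : ∀ v → 2 ≤ M → f ! (g ! v) ∈ component f g v
    fg∈component v = ball⊆component 2 (f∈ball v 1 (g∈ball v 0 (x∈⁅x⁆ v)))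

    gf∈component : ∀ v → 2 ≤ M → g ! (f ! v) ∈ component f g v
    gf∈component v = ball⊆component 2 (g∈ball v 1 (f∈ball v 0 (x∈⁅x⁆ v)))

    three⇒¬small : ∀ {v a b c} → a ∈ component f g v → b ∈ component f g v → c ∈ component f g v →
                   a ≢ b → a ≢ c → b ≢ c → ¬ ∣ component f g v ∣ ≤ 2
    three⇒¬small a∈ b∈ c∈ a≢b a≢c b≢c = ℕ.<⇒≱ (3≤∣p∣ a∈ b∈ c∈ a≢b a≢c b≢c)

  pair-smallPartRoot : ∀ {v w} → toℕ v ≤ toℕ w → f ! v ≡ w → g ! v ≡ w → SmallPartRoot f g v
  pair-smallPartRoot {v} {w} v≤w fv≡w gv≡w = least , ∣p∣≤2 v w in-pair
    where
    in-pair : ∀ x → x ∈ component f g v → x ≡ v ⊎ x ≡ w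
    in-pair = component-closed (λ x → x ≡ v ⊎ x ≡ w) (inj₁ refl)
                (pair-closed f (proj₁ f-npm) fv≡w) (pair-closed g (proj₁ g-npm) gv≡w)
    least : IsLeastInComponent f g v
    least x x∈ with in-pair x x∈
    ... | inj₁ refl = ℕ.≤-refl
    ... | inj₂ refl = v≤w

  smallPartRoot⇐ : ∀ v → CommonEdgeAt f g v ⊎ CommonlyUncovered f g v → SmallPartRoot f g v
  smallPartRoot⇐ v (inj₁ (v<fv , fv≡gv)) = pair-smallPartRoot (ℕ.<⇒≤ v<fv) refl (sym fv≡gv)
  smallPartRoot⇐ v (inj₂ (fv≡v , gv≡v))  = pair-smallPartRoot ℕ.≤-refl fv≡v gv≡v

  smallPartRoot⇒ : ∀ v → SmallPartRoot f g v → CommonEdgeAt f g v ⊎ CommonlyUncovered f g v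
  smallPartRoot⇒ v (least , small) with f ! v ≟ v | g ! v ≟ v
  ... | yes fv≡v | yes gv≡v = inj₂ (fv≡v , gv≡v)
  ... | yes fv≡v | no gv≢v  = ⊥-elim (three⇒¬small (self∈component v) (g∈component v)
        (fg∈component v (distinct⇒2≤n (gv≢v ∘ sym))) (gv≢v ∘ sym) (proj₁ path) (proj₂ path) small)
    where path = uncovered-path-distinct f g f-npm fv≡v gv≢v
  ... | no fv≢v  | yes gv≡v = ⊥-elim (three⇒¬small (self∈component v) (f∈component v)
        (gf∈component v (distinct⇒2≤n (fv≢v ∘ sym))) (fv≢v ∘ sym) (proj₁ path) (proj₂ path) small)
    where path = uncovered-path-distinct g f g-npm gv≡v fv≢v
  ... | no fv≢v  | no gv≢v with f ! v ≟ g ! v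
  ...   | yes fv≡gv =
    inj₁ (ℕ.≤∧≢⇒< (least (f ! v) (f∈component v)) (fv≢v ∘ sym ∘ toℕ-injective) , fv≡gv)
  ...   | no fv≢gv  = ⊥-elim (three⇒¬small (self∈component v) (f∈component v) (g∈component v)
                                (fv≢v ∘ sym) (gv≢v ∘ sym) fv≢gv small)

  smallPartRoot⇔ : ∀ v → SmallPartRoot f g v ⇔ (CommonEdgeAt f g v ⊎ CommonlyUncovered f g v)
  smallPartRoot⇔ v = mk⇔ (smallPartRoot⇒ v) (smallPartRoot⇐ v)

extend-newVertex : ∀ {M} {f : Vec (Fin M) M} → IsNearPerfectMatching f →
                   ∀ {u} → f ! u ≡ u → extend f ! fzero ≡ fsuc u
extend-newVertex {f = f} f-npm fu≡u =
  newPartner-uncovered fu≡u (λ w fw≡w → uncovered-unique f f-npm fu≡u fw≡w)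

module _ {M} {f g : Vec (Fin M) M} (f-npm : IsNearPerfectMatching f) (g-npm : IsNearPerfectMatching g) where

  commonEdgeAt-extend : ∀ j → CommonEdgeAt f g j ⇔ CommonEdgeAt (extend f) (extend g) (fsuc j)
  commonEdgeAt-extend j = mk⇔ to from
    where
    to : CommonEdgeAt f g j → CommonEdgeAt (extend f) (extend g) (fsuc j)
    to (j<fj , fj≡gj) = subst (λ K → toℕ (fsuc j) < toℕ K) (sym F[sj]) (s≤s j<fj)
                      , trans F[sj] (trans (cong fsuc fj≡gj) (sym G[sj]))
      where
      fj≢j : f ! j ≢ j
      fj≢j fj≡j = ℕ.<-irrefl (cong toℕ (sym fj≡j)) j<fj
      F[sj] = extend-covered f fj≢j
      G[sj] = extend-covered g (fj≢j ∘ trans fj≡gj)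
    from : CommonEdgeAt (extend f) (extend g) (fsuc j) → CommonEdgeAt f g j
    from (sj<F[sj] , F[sj]≡G[sj]) with f ! j ≟ j
    ... | yes fj≡j =
      ⊥-elim (ℕ.n≮0 (subst (λ K → toℕ (fsuc j) < toℕ K) (extend-uncovered f fj≡j) sj<F[sj]))
    ... | no fj≢j  = ℕ.≤-pred (subst (λ K → toℕ (fsuc j) < toℕ K) F[sj] sj<F[sj])
                   , sym (extend-fsuc⁻ g (trans (sym F[sj]≡G[sj]) F[sj]))
      where F[sj] = extend-covered f fj≢j

  commonlyUncovered-extend : ∃ (CommonlyUncovered f g) ⇔ CommonEdgeAt (extend f) (extend g) fzero
  commonlyUncovered-extend = mk⇔ to from
    where
    to : ∃ (CommonlyUncovered f g) → CommonEdgeAt (extend f) (extend g) fzero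
    to (v , fv≡v , gv≡v) = subst (λ K → 0 < toℕ K) (sym F0) (s≤s z≤n) , trans F0 (sym G0)
      where
      F0 = extend-newVertex f-npm fv≡v
      G0 = extend-newVertex g-npm gv≡v
    from : CommonEdgeAt (extend f) (extend g) fzero → ∃ (CommonlyUncovered f g)
    from (_ , F0≡G0) with proj₂ f-npm | proj₂ g-npm
    ... | u , fu≡u , _ | u′ , gu′≡u′ , _ = u , fu≡u , subst (λ w → g ! w ≡ w) (sym u≡u′) gu′≡u′
      where
      u≡u′ : u ≡ u′
      u≡u′ = suc-injective (begin
        fsuc u                  ≡⟨ extend-newVertex f-npm fu≡u ⟨
        extend f ! fzero        ≡⟨ F0≡G0 ⟩
        extend g ! fzero        ≡⟨ extend-newVertex g-npm gu′≡u′ ⟩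
        fsuc u′                 ∎)
        where open ≡-Reasoning

  smallParts≡commonEdges-extend : smallParts f g ≡ commonEdges (extend f) (extend g)
  smallParts≡commonEdges-extend = begin
    smallParts f g                             ≡⟨ count-cong _ (λ v → E? v ⊎-dec U? v) smallPartRoot⇔ ⟩
    count (λ v → E? v ⊎-dec U? v)              ≡⟨ count-⊎ E? U? disjoint ⟩
    count E? + count U?                        ≡⟨ ℕ.+-comm (count E?) (count U?) ⟩
    count U? + count E?                        ≡⟨ cong (_+ count E?) (count-subsingleton U? U-unique) ⟩
    (if ⌊ any? U? ⌋ then 1 else 0) + count E?  ≡⟨ cong₂ _+_ new-edge (count-cong _ _ commonEdgeAt-extend) ⟩
    commonEdges (extend f) (extend g)          ∎
    where
    open ≡-Reasoning
    open SmallParts f g f-npm g-npm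
    E? = commonEdgeAt? f g
    U? = commonlyUncovered? f g
    disjoint : ∀ v → CommonEdgeAt f g v → ¬ CommonlyUncovered f g v
    disjoint v (v<fv , _) (fv≡v , _) = ℕ.<-irrefl (cong toℕ (sym fv≡v)) v<fv
    U-unique : ∀ {v w} → CommonlyUncovered f g v → CommonlyUncovered f g w → v ≡ w
    U-unique (fv≡v , _) (fw≡w , _) = uncovered-unique f f-npm fw≡w fv≡v
    new-edge : (if ⌊ any? U? ⌋ then 1 else 0)
             ≡ (if ⌊ commonEdgeAt? (extend f) (extend g) fzero ⌋ then 1 else 0)
    new-edge = cong (λ b → if b then 1 else 0) (⌊⌋-⇔ commonlyUncovered-extend _ _)

smallPartsGraph : ℕ → ℕ → Graph
smallPartsGraph M t = record
  { V   = NearPerfectMatching M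
  ; Adj = λ m m' → smallParts (NearPerfectMatching.vec m) (NearPerfectMatching.vec m') < t }

commonEdgesGraph : ℕ → ℕ → Graph
commonEdgesGraph N t = record
  { V   = PerfectMatching N
  ; Adj = λ m m' → commonEdges (PerfectMatching.vec m) (PerfectMatching.vec m') < t }

nearPerfect-valid : ∀ {M} (m : NearPerfectMatching M) → IsNearPerfectMatching (NearPerfectMatching.vec m)
nearPerfect-valid (npm f f-npm) = recompute (isNearPerfectMatching? f) f-npm

perfect-valid : ∀ {N} (m : PerfectMatching N) → IsPerfectMatching (PerfectMatching.vec m)
perfect-valid (pm G G-pm) = recompute (isPerfectMatching? G) G-pm

pm-≡ : ∀ {N} {u v} → u ≡ v →
       .(p : IsPerfectMatching u) .(q : IsPerfectMatching v) → pm {N} u p ≡ pm v q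
pm-≡ refl _ _ = refl

npm-≡ : ∀ {N} {u v} → u ≡ v →
        .(p : IsNearPerfectMatching u) .(q : IsNearPerfectMatching v) → npm {N} u p ≡ npm v q
npm-≡ refl _ _ = refl

module _ {M : ℕ} where

  extendMatching : NearPerfectMatching M → PerfectMatching (suc M)
  extendMatching m@(npm f _) = pm (extend f) (extend-isPerfectMatching (nearPerfect-valid m))

  restrictMatching : PerfectMatching (suc M) → NearPerfectMatching M
  restrictMatching m@(pm G _) = npm (restrict G) (restrict-isNearPerfectMatching G (perfect-valid m))

  extend∘restrict : ∀ m → extendMatching (restrictMatching m) ≡ m
  extend∘restrict m@(pm G _) = pm-≡ (extend-restrict G (perfect-valid m)) _ _

  restrict∘extend : ∀ m → restrictMatching (extendMatching m) ≡ m
  restrict∘extend (npm f _) = npm-≡ (restrict-extend f) _ _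

smallPartsGraph≅commonEdgesGraph : ∀ M t → smallPartsGraph M t ≅ commonEdgesGraph (suc M) t
smallPartsGraph≅commonEdgesGraph M t = record
  { bij       = ↔⇒⤖ (mk↔ₛ′ extendMatching restrictMatching extend∘restrict restrict∘extend)
  ; adjacency = λ m m' → <-cong (smallParts≡commonEdges-extend (nearPerfect-valid m) (nearPerfect-valid m'))
  }
  where
  <-cong : ∀ {a b} → a ≡ b → (a < t) ⇔ (b < t)
  <-cong a≡b = mk⇔ (subst (_< t) a≡b) (subst (_< t) (sym a≡b))

proposition57 : (n t : ℕ) → 1 ≤ n → Θ n t ≅ Γ n t
proposition57 (suc k) t _ = smallPartsGraph≅commonEdgesGraph (2 * suc k ∸ 1) t
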